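{- Let $m,n,k \geq 2$. Then the poset $\mathbb{P}=m \oplus n \oplus k$ is not 3-S\l upecki, and hence not S\l upecki.
   Context: Posets are viewed as reflexive digraphs with arc relation $\leq$. For $n\geq1$, $n$ also denotes the $n$-element antichain. The ordinal sum $\mathbb{P}\oplus\mathbb{Q}$ is the disjoint union of $\mathbb{P}$ and $\mathbb{Q}$ with additionally $p\leq q$ for all $p\in P$, $q\in Q$. A $k$-ary polymorphism of $\mathbb{P}$ is a monotone map $\mathbb{P}^k\to\mathbb{P}$ (product order); it is essentially unary if it equals $(x_1,\dots,x_k)\mapsto g(x_i)$ for some $i$ and some monotone $g:\mathbb{P}\to\mathbb{P}$. $\mathbb{P}$ is $k$-S\l upecki if every surjective $k$-ary polymorphism is essentially unary, and S\l upecki if it is $k$-S\l upecki for all $k\geq2$. -}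

module Defs where

open import Data.Nat using (ℕ)
open import Data.Fin using (Fin)
open import Data.Sum using (_⊎_; inj₁; inj₂)
open import Data.Product using (Σ; ∃; _×_)
open import Data.Empty using (⊥)
open import Data.Unit using (⊤)
open import Relation.Binary.PropositionalEquality using (_≡_)
open import Relation.Nullary using (¬_)
open import Data.Nat using (_≥_)

record Poset : Set₁ where
  field
    Carrier : Set
    _≤_     : Carrier → Carrier → Set

open Poset public

antichain : ℕ → Poset
antichain n = record { Carrier = Fin n ; _≤_ = _≡_ }

data ⊕-≤ (P Q : Poset) : (Carrier P ⊎ Carrier Q) → (Carrier P ⊎ Carrier Q) → Set where
  ll : ∀ {a b} → _≤_ P a b → ⊕-≤ P Q (inj₁ a) (inj₁ b)
  rr : ∀ {a b} → _≤_ Q a b → ⊕-≤ P Q (inj₂ a) (inj₂ b)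
  lr : ∀ {a b} → ⊕-≤ P Q (inj₁ a) (inj₂ b)

_⊕_ : Poset → Poset → Poset
P ⊕ Q = record { Carrier = Carrier P ⊎ Carrier Q ; _≤_ = ⊕-≤ P Q }

infixl 6 _⊕_

Monotone : (P : Poset) → (Carrier P → Carrier P) → Set
Monotone P g = ∀ x y → _≤_ P x y → _≤_ P (g x) (g y)

Op : Poset → ℕ → Set
Op P k = (Fin k → Carrier P) → Carrier P

IsPolymorphism : (P : Poset) (k : ℕ) → Op P k → Set
IsPolymorphism P k f =
  ∀ (x y : Fin k → Carrier P) → (∀ i → _≤_ P (x i) (y i)) → _≤_ P (f x) (f y)

Surjective : (P : Poset) (k : ℕ) → Op P k → Set
Surjective P k f = ∀ (p : Carrier P) → Σ (Fin k → Carrier P) (λ x → f x ≡ p)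

EssentiallyUnary : (P : Poset) (k : ℕ) → Op P k → Set
EssentiallyUnary P k f =
  Σ (Fin k) λ i → Σ (Carrier P → Carrier P) λ g →
    Monotone P g × (∀ (x : Fin k → Carrier P) → f x ≡ g (x i))

IsKSlupecki : Poset → ℕ → Set
IsKSlupecki P k =
  ∀ (f : Op P k) → IsPolymorphism P k f → Surjective P k f → EssentiallyUnary P k f

IsSlupecki : Poset → Set
IsSlupecki P = ∀ (k : ℕ) → k ≥ 2 → IsKSlupecki P k

-- On P = A ⊕ B ⊕ C consider the ternary operation ω that, when y lies in the
-- top layer C, returns x if x, z ∈ A, returns z if x ∈ A and z ∈ B, and returns
-- y otherwise; and that, when y lies below C, returns x if x ∈ A and a fixed
-- middle element b₀ otherwise. It is monotone and onto, yet ω(a,a,a) = a while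
-- ω(a,c,b₀) = ω(b₀,a,a) = b₀, so none of its arguments determines its value.
module Submission where

open import Defs
open import Data.Nat using (ℕ; _≥_; suc; s≤s; z≤n)
open import Data.Fin using (Fin; zero; suc)
open import Data.Vec.Functional using (_∷_; [])
open import Data.Sum using (inj₁; inj₂)
open import Data.Product using (_×_; _,_; Σ)
open import Relation.Binary.Definitions using (Reflexive)
open import Relation.Binary.PropositionalEquality using (_≡_; _≢_; refl; sym; cong; module ≡-Reasoning)
open import Relation.Nullary using (¬_)

¬kSlupecki⇒¬Slupecki : (P : Poset) (k : ℕ) → k ≥ 2 → ¬ IsKSlupecki P k → ¬ IsSlupecki P
¬kSlupecki⇒¬Slupecki P k k≥2 ¬kSlupecki slupecki = ¬kSlupecki (slupecki k k≥2)

NotDeterminedBy : (P : Poset) (k : ℕ) → Op P k → Fin k → Set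
NotDeterminedBy P k f i =
  Σ (Fin k → Carrier P) λ x → Σ (Fin k → Carrier P) λ y → x i ≡ y i × f x ≢ f y

notDeterminedByAny⇒¬essentiallyUnary : (P : Poset) (k : ℕ) (f : Op P k) →
  (∀ i → NotDeterminedBy P k f i) → ¬ EssentiallyUnary P k f
notDeterminedByAny⇒¬essentiallyUnary P k f undetermined (i , g , _ , f≡g∘πᵢ)
  with undetermined i
... | x , y , xᵢ≡yᵢ , fx≢fy = fx≢fy (begin
  f x     ≡⟨ f≡g∘πᵢ x ⟩
  g (x i) ≡⟨ cong g xᵢ≡yᵢ ⟩
  g (y i) ≡⟨ sym (f≡g∘πᵢ y) ⟩
  f y     ∎)
  where open ≡-Reasoning

module ThreeLayers {A B C : Poset} (B-refl : Reflexive (_≤_ B))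
                   (a₀ : Carrier A) (b₀ : Carrier B) (c₀ : Carrier C) where

  P : Poset
  P = A ⊕ B ⊕ C

  pattern bot a = inj₁ (inj₁ a)
  pattern mid b = inj₁ (inj₂ b)
  pattern top c = inj₂ c

  infix 4 _⊑_
  _⊑_ : Carrier P → Carrier P → Set
  _⊑_ = _≤_ P

  botOrMid : Carrier P → Carrier P
  botOrMid (bot a) = bot a
  botOrMid _       = mid b₀

  climb : Carrier A → Carrier C → Carrier P → Carrier P
  climb a c (bot _) = bot a
  climb a c (mid b) = mid b
  climb a c (top _) = top c

  belowTop : Carrier P → Carrier C → Carrier P → Carrier P
  belowTop (bot a) c z = climb a c z
  belowTop _       c z = top c

  ω : Carrier P → Carrier P → Carrier P → Carrier P
  ω x (top c) z = belowTop x c z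
  ω x _       z = botOrMid x

  botOrMid-mono : ∀ {x x'} → x ⊑ x' → botOrMid x ⊑ botOrMid x'
  botOrMid-mono (ll (ll a≤a'))     = ll (ll a≤a')
  botOrMid-mono (ll (rr _))        = ll (rr B-refl)
  botOrMid-mono (ll lr)            = ll lr
  botOrMid-mono (rr _)             = ll (rr B-refl)
  botOrMid-mono (lr {inj₁ _})       = ll lr
  botOrMid-mono (lr {inj₂ _})       = ll (rr B-refl)

  climb-mono : ∀ {a a' c c' z z'} → _≤_ A a a' → _≤_ C c c' → z ⊑ z' →
               climb a c z ⊑ climb a' c' z'
  climb-mono a≤a' c≤c' (ll (ll _))    = ll (ll a≤a')
  climb-mono a≤a' c≤c' (ll (rr b≤b')) = ll (rr b≤b')
  climb-mono a≤a' c≤c' (ll lr)        = ll lr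
  climb-mono a≤a' c≤c' (rr _)         = rr c≤c'
  climb-mono a≤a' c≤c' (lr {inj₁ _})   = lr
  climb-mono a≤a' c≤c' (lr {inj₂ _})   = lr

  belowTop-⊑-top : ∀ {c c'} x z → _≤_ C c c' → belowTop x c z ⊑ top c'
  belowTop-⊑-top (bot _) (bot _) c≤c' = lr
  belowTop-⊑-top (bot _) (mid _) c≤c' = lr
  belowTop-⊑-top (bot _) (top _) c≤c' = rr c≤c'
  belowTop-⊑-top (mid _) z       c≤c' = rr c≤c'
  belowTop-⊑-top (top _) z       c≤c' = rr c≤c'

  belowTop-mono : ∀ {x x' c c' z z'} → x ⊑ x' → _≤_ C c c' → z ⊑ z' →
                  belowTop x c z ⊑ belowTop x' c' z'
  belowTop-mono (ll (ll a≤a')) c≤c' z⊑z' = climb-mono a≤a' c≤c' z⊑z'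
  belowTop-mono {x} {z = z} (ll (rr _)) c≤c' _ = belowTop-⊑-top x z c≤c'
  belowTop-mono {x} {z = z} (ll lr)     c≤c' _ = belowTop-⊑-top x z c≤c'
  belowTop-mono {x} {z = z} (rr _)      c≤c' _ = belowTop-⊑-top x z c≤c'
  belowTop-mono {x} {z = z} lr          c≤c' _ = belowTop-⊑-top x z c≤c'

  -- Since botOrMid never leaves A ⊕ B, only the case x, x' ∈ A is not immediate.
  botOrMid-⊑-belowTop : ∀ {x x'} c z → x ⊑ x' → botOrMid x ⊑ belowTop x' c z
  botOrMid-⊑-belowTop c (bot _) (ll (ll a≤a')) = ll (ll a≤a')
  botOrMid-⊑-belowTop c (mid _) (ll (ll _))    = ll lr
  botOrMid-⊑-belowTop c (top _) (ll (ll _))    = lr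
  botOrMid-⊑-belowTop c z       (ll (rr _))    = lr
  botOrMid-⊑-belowTop c z       (ll lr)        = lr
  botOrMid-⊑-belowTop c z       (rr _)         = lr
  botOrMid-⊑-belowTop c z       (lr {inj₁ _})   = lr
  botOrMid-⊑-belowTop c z       (lr {inj₂ _})   = lr

  ω-mono : ∀ {x x' y y' z z'} → x ⊑ x' → y ⊑ y' → z ⊑ z' → ω x y z ⊑ ω x' y' z'
  ω-mono x⊑x' (ll _)    z⊑z' = botOrMid-mono x⊑x'
  ω-mono x⊑x' (rr c≤c') z⊑z' = belowTop-mono x⊑x' c≤c' z⊑z'
  ω-mono {z' = z'} x⊑x' (lr {_} {c'}) z⊑z' = botOrMid-⊑-belowTop c' z' x⊑x'

  f : Op P 3
  f xs = ω (xs zero) (xs (suc zero)) (xs (suc (suc zero)))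

  f-polymorphism : IsPolymorphism P 3 f
  f-polymorphism xs ys xs⊑ys =
    ω-mono (xs⊑ys zero) (xs⊑ys (suc zero)) (xs⊑ys (suc (suc zero)))

  f-surjective : Surjective P 3 f
  f-surjective (bot a) = (bot a ∷ bot a ∷ bot a ∷ []) , refl
  f-surjective (mid b) = (bot a₀ ∷ top c₀ ∷ mid b ∷ []) , refl
  f-surjective (top c) = (top c ∷ top c ∷ top c ∷ []) , refl

  f-notDeterminedByAny : ∀ i → NotDeterminedBy P 3 f i
  f-notDeterminedByAny zero =
    (bot a₀ ∷ bot a₀ ∷ bot a₀ ∷ []) , (bot a₀ ∷ top c₀ ∷ mid b₀ ∷ []) , refl , λ ()
  f-notDeterminedByAny (suc zero) =
    (bot a₀ ∷ bot a₀ ∷ bot a₀ ∷ []) , (mid b₀ ∷ bot a₀ ∷ bot a₀ ∷ []) , refl , λ ()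
  f-notDeterminedByAny (suc (suc zero)) =
    (bot a₀ ∷ bot a₀ ∷ bot a₀ ∷ []) , (mid b₀ ∷ bot a₀ ∷ bot a₀ ∷ []) , refl , λ ()

  ¬3Slupecki : ¬ IsKSlupecki P 3
  ¬3Slupecki slupecki =
    notDeterminedByAny⇒¬essentiallyUnary P 3 f f-notDeterminedByAny
      (slupecki f f-polymorphism f-surjective)

theorem5p2 : (m n k : ℕ) → m ≥ 2 → n ≥ 2 → k ≥ 2 →
    ¬ IsKSlupecki (antichain m ⊕ antichain n ⊕ antichain k) 3
      × ¬ IsSlupecki (antichain m ⊕ antichain n ⊕ antichain k)
theorem5p2 (suc m) (suc n) (suc k) _ _ _ =
  ¬3Slupecki , ¬kSlupecki⇒¬Slupecki P 3 (s≤s (s≤s z≤n)) ¬3Slupecki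
  where open ThreeLayers {antichain (suc m)} {antichain (suc n)} {antichain (suc k)}
                         refl zero zero zero
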